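{- Let $G$ be a finite simple graph with vertex set $\{1,\dots,n\}$ and no isolated vertices, with degree pairs $(d_i,m_i)_{i=1}^n$. If $$\max_{1\leq i\leq n} d_im_i\geq n,$$ then the girth of $G$ is at most $4$ (i.e. $G$ contains a cycle of length $3$ or $4$).
   Context: For a vertex $i$ of $G$, $d_i$ is the degree of $i$ and $m_i=d_i^{ -1}\sum_{j:\, ji\in E(G)} d_j$ is the average of the degrees of the neighbors of $i$ (the average $2$-degree). The sequence $(d_i,m_i)_{i=1}^n$ is called the sequence of degree pairs of $G$. The girth is the length of a shortest cycle. -}

module Defs where

open import Data.Nat using (ℕ; zero; suc; _+_; _∸_)
open import Data.Bool using (Bool; true; false; if_then_else_)
open import Data.Fin using (Fin)
open import Data.List using (List; map; allFin)
open import Data.Nat.ListAction using (sum)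
open import Data.Integer using (+_)
open import Data.Rational.Unnormalised using (ℚᵘ; mkℚᵘ)
open import Relation.Binary.PropositionalEquality using (_≡_; _≢_)

record SimpleGraph (n : ℕ) : Set where
  field
    adj   : Fin n → Fin n → Bool
    sym   : ∀ i j → adj i j ≡ adj j i
    irrefl : ∀ i → adj i i ≡ false
open SimpleGraph public

Σv : ∀ {n} → (Fin n → ℕ) → ℕ
Σv {n} f = sum (map f (allFin n))

deg : ∀ {n} → SimpleGraph n → Fin n → ℕ
deg G i = Σv (λ j → if adj G i j then 1 else 0)

nbrDegSum : ∀ {n} → SimpleGraph n → Fin n → ℕ
nbrDegSum G i = Σv (λ j → if adj G i j then deg G j else 0)

-- The denominator is (d_i ∸ 1) + 1 = d_i whenever d_i ≥ 1 (no isolated vertices);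
-- for d_i = 0 the value is a junk value never used under the hypotheses.
avgNbrDeg : ∀ {n} → SimpleGraph n → Fin n → ℚᵘ
avgNbrDeg G i = mkℚᵘ (+ nbrDegSum G i) (deg G i ∸ 1)

NoIsolated : ∀ {n} → SimpleGraph n → Set
NoIsolated G = ∀ i → deg G i ≢ 0

HasC3 : ∀ {n} → SimpleGraph n → Set
HasC3 {n} G = Σ3
  where
  open import Data.Product using (Σ; _×_)
  Σ3 = Σ (Fin n) λ a → Σ (Fin n) λ b → Σ (Fin n) λ c →
         (a ≢ b) × (b ≢ c) × (a ≢ c) ×
         (adj G a b ≡ true) × (adj G b c ≡ true) × (adj G c a ≡ true)

HasC4 : ∀ {n} → SimpleGraph n → Set
HasC4 {n} G = Σ4
  where
  open import Data.Product using (Σ; _×_)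
  Σ4 = Σ (Fin n) λ a → Σ (Fin n) λ b → Σ (Fin n) λ c → Σ (Fin n) λ d →
         (a ≢ b) × (a ≢ c) × (a ≢ d) × (b ≢ c) × (b ≢ d) × (c ≢ d) ×
         (adj G a b ≡ true) × (adj G b c ≡ true) × (adj G c d ≡ true) × (adj G d a ≡ true)

module Submission where

-- Since d_i m_i = Σ_{j ~ i} d_j =: S_i, it suffices to show that in a graph
-- without 3- and 4-cycles every vertex has S_i < n.  Write c_k for the number
-- of common neighbours of i and k.  Counting the walks i - j - k in two ways
-- gives S_i = Σ_k c_k, and
--   * c_i = d_i,
--   * c_k = 0 when k ~ i       (a common neighbour would close a triangle),
--   * c_k ≤ 1 when k ≠ i       (two common neighbours would close a 4-cycle).
-- So vertex i contributes d_i, its d_i neighbours contribute 0, and the other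
-- n - 1 - d_i vertices contribute at most 1 each: S_i ≤ n - 1.  To avoid
-- truncated subtraction we sum the pointwise bound
--   c_k + [k ~ i] + [k = i] ≤ d_i·[k = i] + 1,
-- which yields S_i + d_i + 1 ≤ d_i + n.

open import Defs
open import Data.Nat using (ℕ)
open import Data.Fin using (Fin)
open import Data.Product using (∃)
open import Data.Sum using (_⊎_)
open import Data.Integer using (+_)
open import Data.Rational.Unnormalised using (_≤_; _*_; mkℚᵘ)

open import Data.Nat using (zero; suc; _+_; _<_; z≤n) renaming (_*_ to _*ℕ_; _≤_ to _≤ℕ_)
open import Data.Nat.Properties
  using ( +-identityʳ; *-identityˡ; *-identityʳ; *-comm; +-comm; +-assoc; ≤-refl; ≤-reflexive
        ; ≤-trans; +-mono-≤; +-cancelˡ-≤; *-cancelʳ-≤; <-irrefl; <-≤-trans; +-0-commutativeMonoid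
        ; module ≤-Reasoning )
open import Data.Integer using () renaming (_*_ to _*ℤ_; _≤_ to _≤ℤ_)
open import Data.Integer.Properties using (pos-*; drop‿+≤+)
open import Data.Rational.Unnormalised using (*≤*)
open import Data.Fin using (zero; suc)
open import Data.Fin.Properties using (_≟_; any?; suc-injective)
open import Data.Bool using (Bool; true; false; if_then_else_; _∧_)
open import Data.Bool.Properties using (∧-idem) renaming (_≟_ to _≟ᵇ_)
open import Data.List using (tabulate)
open import Data.List.Properties using (map-tabulate)
open import Data.Nat.ListAction using (sum)
open import Data.Product using (_,_)
open import Data.Sum using (inj₁; inj₂)
open import Data.Empty using (⊥-elim)
open import Relation.Nullary using (¬_; Dec; yes; no; does)
open import Relation.Nullary.Decidable using (_×-dec_; ¬?)
open import Relation.Binary.PropositionalEquality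
  using (_≡_; _≢_; refl; trans; cong; cong₂; subst; subst₂; module ≡-Reasoning)
  renaming (sym to ≡-sym)
open import Algebra.Properties.CommutativeMonoid.Sum +-0-commutativeMonoid
  using (∑-distrib-+; ∑-comm; sum-cong-≗; sum-replicate-zero)
  renaming (sum to ∑ᵛ)

∑ : ∀ {n} → (Fin n → ℕ) → ℕ
∑ = ∑ᵛ

[_] : Bool → ℕ
[ b ] = if b then 1 else 0

point : ∀ {n} → Fin n → ℕ → Fin n → ℕ
point i x k = if does (k ≟ i) then x else 0

Σv≡∑ : ∀ {n} (f : Fin n → ℕ) → Σv f ≡ ∑ f
Σv≡∑ {n} f = trans (cong sum (map-tabulate {n = n} (λ k → k) f)) (sum-tabulate f)
  where
  sum-tabulate : ∀ {m} (g : Fin m → ℕ) → sum (tabulate g) ≡ ∑ g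
  sum-tabulate {zero} g = refl
  sum-tabulate {suc m} g = cong (λ s → g zero + s) (sum-tabulate (λ k → g (suc k)))

∑-const-1 : ∀ n → ∑ {n} (λ _ → 1) ≡ n
∑-const-1 zero = refl
∑-const-1 (suc n) = cong suc (∑-const-1 n)

∑-mono-≤ : ∀ {n} {f g : Fin n → ℕ} → (∀ k → f k ≤ℕ g k) → ∑ f ≤ℕ ∑ g
∑-mono-≤ {zero} f≤g = ≤-refl
∑-mono-≤ {suc n} f≤g = +-mono-≤ (f≤g zero) (∑-mono-≤ (λ k → f≤g (suc k)))

∑-point : ∀ {n} (i : Fin n) (x : ℕ) → ∑ (point i x) ≡ x
∑-point {suc n} zero x = trans (cong (λ s → x + s) (sum-replicate-zero n)) (+-identityʳ x)
∑-point {suc n} (suc i) x = ∑-point i x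

∑-atMostOne : ∀ {n} (b : Fin n → Bool) →
  (∀ j j′ → b j ≡ true → b j′ ≡ true → j ≡ j′) → ∑ (λ j → [ b j ]) ≤ℕ 1
∑-atMostOne {zero} b unique = z≤n
∑-atMostOne {suc n} b unique with b zero in b₀
... | false = ∑-atMostOne (λ j → b (suc j)) (λ j j′ p q → suc-injective (unique (suc j) (suc j′) p q))
... | true = ≤-reflexive (cong suc (trans (sum-cong-≗ restFalse) (sum-replicate-zero n)))
  where
  restFalse : ∀ k → [ b (suc k) ] ≡ 0
  restFalse k with b (suc k) in bₖ
  ... | false = refl
  ... | true with unique zero (suc k) b₀ bₖ
  ...   | ()

adj⇒≢ : ∀ {n} (G : SimpleGraph n) {x y : Fin n} → adj G x y ≡ true → x ≢ y
adj⇒≢ G {x} xy refl with trans (≡-sym xy) (irrefl G x)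
... | ()

adj-sym : ∀ {n} (G : SimpleGraph n) {x y : Fin n} → adj G x y ≡ true → adj G y x ≡ true
adj-sym G {x} {y} xy = trans (SimpleGraph.sym G y x) xy

deg≡∑ : ∀ {n} (G : SimpleGraph n) (x : Fin n) → deg G x ≡ ∑ (λ y → [ adj G x y ])
deg≡∑ G x = Σv≡∑ (λ y → [ adj G x y ])

HasC3? : ∀ {n} (G : SimpleGraph n) → Dec (HasC3 G)
HasC3? G = any? λ a → any? λ b → any? λ c →
  ¬? (a ≟ b) ×-dec ¬? (b ≟ c) ×-dec ¬? (a ≟ c) ×-dec
  (adj G a b ≟ᵇ true) ×-dec (adj G b c ≟ᵇ true) ×-dec (adj G c a ≟ᵇ true)

HasC4? : ∀ {n} (G : SimpleGraph n) → Dec (HasC4 G)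
HasC4? G = any? λ a → any? λ b → any? λ c → any? λ d →
  ¬? (a ≟ b) ×-dec ¬? (a ≟ c) ×-dec ¬? (a ≟ d) ×-dec ¬? (b ≟ c) ×-dec ¬? (b ≟ d) ×-dec ¬? (c ≟ d) ×-dec
  (adj G a b ≟ᵇ true) ×-dec (adj G b c ≟ᵇ true) ×-dec (adj G c d ≟ᵇ true) ×-dec (adj G d a ≟ᵇ true)

codeg : ∀ {n} → SimpleGraph n → Fin n → Fin n → ℕ
codeg G i k = ∑ (λ j → [ adj G i j ∧ adj G j k ])

module _ {n : ℕ} (G : SimpleGraph n) (i : Fin n) where

  nbrDegSum≡∑codeg : nbrDegSum G i ≡ ∑ (codeg G i)
  nbrDegSum≡∑codeg = begin
    nbrDegSum G i                                   ≡⟨ Σv≡∑ (λ j → if adj G i j then deg G j else 0) ⟩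
    ∑ (λ j → if adj G i j then deg G j else 0)      ≡⟨ sum-cong-≗ degAsWalks ⟩
    ∑ (λ j → ∑ (λ k → [ adj G i j ∧ adj G j k ]))   ≡⟨ ∑-comm (λ j k → [ adj G i j ∧ adj G j k ]) ⟩
    ∑ (codeg G i)                                   ∎
    where
    open ≡-Reasoning
    degAsWalks : ∀ j → (if adj G i j then deg G j else 0) ≡ ∑ (λ k → [ adj G i j ∧ adj G j k ])
    degAsWalks j with adj G i j
    ... | true = deg≡∑ G j
    ... | false = ≡-sym (sum-replicate-zero n)

  codeg-self : codeg G i i ≡ deg G i
  codeg-self = trans (sum-cong-≗ backAndForth) (≡-sym (deg≡∑ G i))
    where
    backAndForth : ∀ j → [ adj G i j ∧ adj G j i ] ≡ [ adj G i j ]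
    backAndForth j rewrite SimpleGraph.sym G j i = cong [_] (∧-idem (adj G i j))

  codeg-adj : ¬ HasC3 G → ∀ k → adj G i k ≡ true → codeg G i k ≡ 0
  codeg-adj noC3 k ik = trans (sum-cong-≗ noWalk) (sum-replicate-zero n)
    where
    noWalk : ∀ j → [ adj G i j ∧ adj G j k ] ≡ 0
    noWalk j with adj G i j in ij | adj G j k in jk
    ... | false | _ = refl
    ... | true | false = refl
    ... | true | true =
      ⊥-elim (noC3 (i , j , k , adj⇒≢ G ij , adj⇒≢ G jk , adj⇒≢ G ik , ij , jk , adj-sym G ik))

  codeg-≤1 : ¬ HasC4 G → ∀ k → k ≢ i → codeg G i k ≤ℕ 1
  codeg-≤1 noC4 k k≢i = ∑-atMostOne (λ j → adj G i j ∧ adj G j k) unique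
    where
    unique : ∀ j j′ → (adj G i j ∧ adj G j k) ≡ true → (adj G i j′ ∧ adj G j′ k) ≡ true → j ≡ j′
    unique j j′ p q with j ≟ j′
    ... | yes j≡j′ = j≡j′
    ... | no j≢j′ with adj G i j in ij | adj G j k in jk | adj G i j′ in ij′ | adj G j′ k in j′k | p | q
    ...   | true | true | true | true | _ | _ =
      ⊥-elim (noC4 (i , j , k , j′ , adj⇒≢ G ij , (λ i≡k → k≢i (≡-sym i≡k)) , adj⇒≢ G ij′ ,
                    adj⇒≢ G jk , j≢j′ , adj⇒≢ G (adj-sym G j′k) ,
                    ij , jk , adj-sym G j′k , adj-sym G ij′))

  codeg-pointwise : ¬ HasC3 G → ¬ HasC4 G → ∀ k →
    codeg G i k + [ adj G i k ] + point i 1 k ≤ℕ point i (deg G i) k + 1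
  codeg-pointwise noC3 noC4 k with k ≟ i
  ... | yes refl rewrite codeg-self | irrefl G i = ≤-reflexive (cong (_+ 1) (+-identityʳ (deg G i)))
  ... | no k≢i with adj G i k in ik
  ...   | true rewrite codeg-adj noC3 k ik = ≤-refl
  ...   | false = ≤-trans (≤-reflexive (trans (+-identityʳ _) (+-identityʳ _))) (codeg-≤1 noC4 k k≢i)

  nbrDegSum<n : ¬ HasC3 G → ¬ HasC4 G → nbrDegSum G i < n
  nbrDegSum<n noC3 noC4 = +-cancelˡ-≤ d (suc S) n (subst (_≤ℕ d + n) rearrange summed)
    where
    open ≤-Reasoning
    S = nbrDegSum G i
    d = deg G i
    summed : S + d + 1 ≤ℕ d + n
    summed = begin
      S + d + 1
        ≡⟨ cong₂ (λ x y → x + y + 1) nbrDegSum≡∑codeg (deg≡∑ G i) ⟩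
      ∑ (codeg G i) + ∑ (λ k → [ adj G i k ]) + 1
        ≡⟨ cong₂ _+_ (≡-sym (∑-distrib-+ (codeg G i) _)) (≡-sym (∑-point i 1)) ⟩
      ∑ (λ k → codeg G i k + [ adj G i k ]) + ∑ (point i 1)
        ≡⟨ ≡-sym (∑-distrib-+ _ (point i 1)) ⟩
      ∑ (λ k → codeg G i k + [ adj G i k ] + point i 1 k)
        ≤⟨ ∑-mono-≤ (codeg-pointwise noC3 noC4) ⟩
      ∑ (λ k → point i d k + 1)
        ≡⟨ ∑-distrib-+ (point i d) (λ _ → 1) ⟩
      ∑ (point i d) + ∑ {n} (λ _ → 1)
        ≡⟨ cong₂ _+_ (∑-point i d) (∑-const-1 n) ⟩
      d + n ∎
    rearrange : S + d + 1 ≡ d + suc S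
    rearrange = trans (+-assoc S d 1) (trans (+-comm S (d + 1)) (+-assoc d 1 S))

-- Clearing denominators: for a vertex of degree d+1 with neighbour-degree sum
-- S, the rational inequality a ≤ (d+1)·(S/(d+1)) says a ≤ S.
ℚ-bound⇒ℕ-bound : ∀ a d S → mkℚᵘ (+ a) 0 ≤ mkℚᵘ (+ suc d) 0 * mkℚᵘ (+ S) d → a ≤ℕ S
ℚ-bound⇒ℕ-bound a d S (*≤* cross) = *-cancelʳ-≤ a S (suc d) (subst₂ _≤ℕ_ lhs rhs (drop‿+≤+ crossℕ))
  where
  crossℤ : + a *ℤ + (1 *ℕ suc d) ≤ℤ (+ suc d *ℤ + S) *ℤ + 1
  crossℤ = cross
  crossℕ : + (a *ℕ (1 *ℕ suc d)) ≤ℤ + ((suc d *ℕ S) *ℕ 1)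
  crossℕ = subst₂ _≤ℤ_ (≡-sym (pos-* a _))
    (trans (cong (_*ℤ + 1) (≡-sym (pos-* (suc d) S))) (≡-sym (pos-* (suc d *ℕ S) 1))) crossℤ
  lhs : a *ℕ (1 *ℕ suc d) ≡ a *ℕ suc d
  lhs = cong (a *ℕ_) (*-identityˡ (suc d))
  rhs : (suc d *ℕ S) *ℕ 1 ≡ S *ℕ suc d
  rhs = trans (*-identityʳ _) (*-comm (suc d) S)

n≤nbrDegSum : ∀ {n} (G : SimpleGraph n) (i : Fin n) → deg G i ≢ 0 →
  mkℚᵘ (+ n) 0 ≤ mkℚᵘ (+ deg G i) 0 * avgNbrDeg G i → n ≤ℕ nbrDegSum G i
n≤nbrDegSum {n} G i nonIsolated h with deg G i
... | zero = ⊥-elim (nonIsolated refl)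
... | suc d = ℚ-bound⇒ℕ-bound n d (nbrDegSum G i) h

proposition2p4 : (n : ℕ) (G : SimpleGraph n) → NoIsolated G →
    (∃ λ (i : Fin n) → mkℚᵘ (+ n) 0 ≤ mkℚᵘ (+ deg G i) 0 * avgNbrDeg G i) →
    HasC3 G ⊎ HasC4 G
proposition2p4 n G noIsolated (i , dm≥n) with HasC3? G | HasC4? G
... | yes c3 | _ = inj₁ c3
... | no _ | yes c4 = inj₂ c4
... | no noC3 | no noC4 =
  ⊥-elim (<-irrefl refl (<-≤-trans (nbrDegSum<n G i noC3 noC4) (n≤nbrDegSum G i (noIsolated i) dm≥n)))
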